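{- For a nonnegative integer $n$: $n$ is even and $v(n)=2$ if and only if $n\in\{18,22,24,28\}$.
   Context: Let $\Sigma^*$ be the free monoid of finite words over the alphabet $\{0,1,2\}$ (including the empty word). A word $x_0x_1\cdots x_k\in\Sigma^*$ with $x_0\neq 0$ is a hyperbinary expansion of the nonnegative integer $\sum_{i=0}^k x_i2^{k-i}$; by convention the empty word is the unique hyperbinary expansion of $0$. Let $\mathcal{H}(n)$ be the set of hyperbinary expansions of $n$. The directed graph $A(n)$ has vertex set $\mathcal{H}(n)$; its arcs are all pairs $(u,w)$ of elements of $\mathcal{H}(n)$ of one of the forms $(\mathbf{x}02\mathbf{y},\mathbf{x}10\mathbf{y})$, $(2\mathbf{y},10\mathbf{y})$, or $(\mathbf{x}12\mathbf{y},\mathbf{x}20\mathbf{y})$, with $\mathbf{x},\mathbf{y}\in\Sigma^*$. The cyclomatic number $v(n)$ of $A(n)$ is (number of arcs) $-$ (number of vertices) $+$ (number of connected components of the underlying undirected graph). -}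

module Defs where

open import Data.Bool using (Bool; true; false; _∧_; _∨_; not; if_then_else_)
open import Data.Fin using (Fin; zero; suc; toℕ)
import Data.Fin.Properties as FinP
open import Data.List using (List; []; _∷_; _++_; length; map; filter; concatMap; upTo; foldl)
open import Data.Bool.ListAction using (any)
import Data.List.Properties as ListP
open import Data.Nat.Logarithm using (⌊log₂_⌋)
open import Data.Nat using (ℕ; zero; suc; _+_; _*_)
import Data.Nat.Properties as NatP
open import Data.Integer using (ℤ; +_; _-_) renaming (_+_ to _+ℤ_)
open import Data.Product using (_×_; _,_; proj₁; proj₂)
open import Relation.Nullary.Decidable using (⌊_⌋)

boolFilter : {A : Set} → (A → Bool) → List A → List A
boolFilter p [] = []
boolFilter p (x ∷ xs) = if p x then x ∷ boolFilter p xs else boolFilter p xs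

Digit : Set
Digit = Fin 3

pattern d0 = zero
pattern d1 = suc zero
pattern d2 = suc (suc zero)

-- Words over {0,1,2}, most significant digit first: x₀ x₁ ⋯ x_k
Word : Set
Word = List Digit

_==_ : Word → Word → Bool
u == w = ⌊ ListP.≡-dec FinP._≟_ u w ⌋

value : Word → ℕ
value = foldl (λ acc d → 2 * acc + toℕ d) 0

leadOK : Word → Bool
leadOK []       = true
leadOK (d0 ∷ _) = false
leadOK (_ ∷ _)  = true

isHyper : ℕ → Word → Bool
isHyper n w = leadOK w ∧ ⌊ value w NatP.≟ n ⌋

wordsOfLen : ℕ → List Word
wordsOfLen zero    = [] ∷ []
wordsOfLen (suc L) = concatMap (λ w → (d0 ∷ w) ∷ (d1 ∷ w) ∷ (d2 ∷ w) ∷ []) (wordsOfLen L)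

wordsUpTo : ℕ → List Word
wordsUpTo L = concatMap wordsOfLen (upTo (suc L))

-- H(n): the hyperbinary expansions of n, listed without repetition.
-- (A hyperbinary expansion of n of length L ≥ 1 has value ≥ 2^(L-1), so
-- L ≤ 1 + ⌊log₂ n⌋; hence searching words of length ≤ 1 + ⌊log₂ n⌋ finds all.)
H : ℕ → List Word
H n = boolFilter (isHyper n) (wordsUpTo (suc ⌊log₂ n ⌋))

rewrites : Word → List Word
rewrites u = front u ++ inner u
  where
  front : Word → List Word
  front (d2 ∷ y) = (d1 ∷ d0 ∷ y) ∷ []
  front _        = []
  inner : Word → List Word
  inner [] = []
  inner (a ∷ rest) = here (a ∷ rest) ++ map (a ∷_) (inner rest)
    where
    here : Word → List Word
    here (d0 ∷ d2 ∷ y) = (d1 ∷ d0 ∷ y) ∷ []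
    here (d1 ∷ d2 ∷ y) = (d2 ∷ d0 ∷ y) ∷ []
    here _             = []

isArcForm : Word → Word → Bool
isArcForm u w = any (_== w) (rewrites u)

_∈ᵇ_ : Word → List Word → Bool
w ∈ᵇ ws = any (_== w) ws

allPairs : List Word → List (Word × Word)
allPairs vs = concatMap (λ u → map (u ,_) vs) vs

arcs : ℕ → List (Word × Word)
arcs n = boolFilter (λ p → isArcForm (proj₁ p) (proj₂ p)) (allPairs (H n))

adj : ℕ → Word → Word → Bool
adj n u w = ((u ∈ᵇ H n) ∧ (w ∈ᵇ H n)) ∧ (isArcForm u w ∨ isArcForm w u)

conn : ℕ → ℕ → Word → Word → Bool
conn n zero    u w = u == w
conn n (suc k) u w = conn n k u w ∨ any (λ z → conn n k u z ∧ adj n z w) (H n)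

-- number of connected components: count vertices (in the list H n) that are not
-- connected to any earlier vertex (walks of length ≤ |V| suffice)
countComponents : ℕ → ℕ
countComponents n = go [] (H n)
  where
  go : List Word → List Word → ℕ
  go seen [] = 0
  go seen (u ∷ us) =
    if any (λ z → conn n (length (H n)) z u) seen
    then go (u ∷ seen) us
    else suc (go (u ∷ seen) us)

v : ℕ → ℤ
v n = ((+ length (arcs n)) - (+ length (H n))) +ℤ (+ countComponents n)

-- The arcs of A(n) are carries: x02y → x10y, x12y → x20y and 2y → 10y. The expansions of 2k+1 are
-- those of k followed by 1; those of 2k+2 are those of k+1 followed by 0 and those of k followed
-- by 2. Appending a digit keeps the arcs of an expansion and adds one, the carry into the new
-- digit, exactly when a 2 is appended to an expansion not ending in 2. The carry from b2, for b
-- the binary expansion of k, joins the two halves of A(2k+2); hence every A(n) is connected and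
-- v(n) = #arcs - #vertices + 1. With N(k) the number of expansions of k and c(k) ≥ 1 the number of
-- those not ending in 2, this gives
--   v(2k+1) = v(k),   v(2k+2) = v(k+1) + v(k) + c(k) - 1,   c(2k+1) = N(k),   c(2k+2) = N(k+1).
-- These recurrences commute with saturating v at 3 and N, c at 4, so whether v(2m) = 2 is decided
-- by a finite automaton reading the binary digits of m; its reachable states are enumerated and
-- the claim is checked on each of them.
{-# OPTIONS --safe #-}
module Submission where

open import Defs
open import Data.Nat using (ℕ)
open import Data.Nat.Divisibility using (_∣_)
open import Data.Integer using (+_)
open import Data.Product using (_×_)
open import Data.Sum using (_⊎_)
open import Relation.Binary.PropositionalEquality using (_≡_)
open import Function.Bundles using (_⇔_)

open import Data.Bool using (Bool; true; false; T)
open import Data.Bool.Properties using (T?; T-∧; T-∨)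
open import Data.Bool.ListAction using (any)
open import Data.Empty using (⊥; ⊥-elim)
open import Data.Fin using (toℕ)
open import Data.Integer using () renaming (_+_ to _+ℤ_; _-_ to _-ℤ_)
import Data.Integer.Properties as ℤ
import Data.Integer.Tactic.RingSolver as ℤ-Solver
open import Data.List
  using (List; []; _∷_; _++_; _∷ʳ_; [_]; length; map; filterᵇ; concatMap; foldl; drop; fromMaybe; deduplicate)
import Data.List.Properties as List
open import Data.List.Membership.Propositional using (_∈_)
open import Data.List.Membership.Propositional.Properties
  using (∈-map⁺; ∈-map⁻; ∈-++⁺ˡ; ∈-++⁺ʳ; ∈-++⁻; ∈-filter⁺; ∈-filter⁻; ∈-upTo⁺)
open import Data.List.Membership.Propositional.Properties.WithK using (unique∧set⇒bag)
open import Data.List.Membership.DecPropositional using (_∈?_)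
open import Data.List.Relation.Binary.BagAndSetEquality using (∼bag⇒↭)
open import Data.List.Relation.Binary.Permutation.Propositional using (_↭_; ↭-sym)
import Data.List.Relation.Binary.Permutation.Propositional.Properties as ↭
open import Data.List.Relation.Unary.All using (All; []; _∷_; all?)
import Data.List.Relation.Unary.All as All
import Data.List.Relation.Unary.All.Properties as All
open import Data.List.Relation.Unary.AllPairs using ([]; _∷_)
open import Data.List.Relation.Unary.Any using (here; there)
import Data.List.Relation.Unary.Any as Any
open import Data.List.Relation.Unary.Any.Properties using (any⁺; any⁻)
open import Data.List.Relation.Unary.Unique.Propositional using (Unique)
import Data.List.Relation.Unary.Unique.Propositional.Properties as Unique
open import Data.List.Reverse using (reverseView; []; _∶_∶ʳ_)
open import Data.Maybe using (Maybe; just; nothing)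
import Data.Maybe as Maybe
import Data.Maybe.Properties as Maybe
open import Data.Nat
  using (zero; suc; _+_; _*_; _^_; _∸_; _⊓_; _≤_; _<_; _≤‴_; ≤‴-reflexive; ≤‴-step; z≤n; s≤s)
import Data.Nat.Properties as ℕ
open import Data.Nat.Divisibility using (divides)
open import Data.Nat.Induction using (<-rec)
open import Data.Nat.ListAction using (sum)
open import Data.Nat.ListAction.Properties using (sum-++; sum-↭)
open import Data.Nat.Logarithm using (⌊log₂_⌋; ⌊log₂⌋-mono-≤; ⌊log₂[2^n]⌋≡n)
open import Data.Nat.Tactic.RingSolver using (solve-∀)
open import Data.Product using (_,_; proj₁; proj₂; ∃)
import Data.Product as Product
import Data.Product.Properties as Product
open import Data.Sum using (inj₁; inj₂)
import Data.Sum as Sum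
open import Function using (_∘_; Equivalence; mk⇔)
open import Relation.Binary using (DecidableEquality)
open import Relation.Binary.PropositionalEquality
  using (_≢_; refl; sym; trans; cong; cong₂; subst; subst₂; module ≡-Reasoning)
open import Relation.Nullary using (¬_)
open import Relation.Nullary.Decidable using (Dec; toWitness; fromWitness; from-yes; _×-dec_; _→-dec_; _⊎-dec_)

boolFilter≡filterᵇ : ∀ {A : Set} (p : A → Bool) xs → boolFilter p xs ≡ filterᵇ p xs
boolFilter≡filterᵇ p [] = refl
boolFilter≡filterᵇ p (x ∷ xs) with p x
... | true  = cong (x ∷_) (boolFilter≡filterᵇ p xs)
... | false = boolFilter≡filterᵇ p xs

module _ {A : Set} (p : A → Bool) {xs : List A} where

  ∈-boolFilter⁺ : ∀ {x} → x ∈ xs → T (p x) → x ∈ boolFilter p xs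
  ∈-boolFilter⁺ x∈ px = subst (_ ∈_) (sym (boolFilter≡filterᵇ p xs)) (∈-filter⁺ (T? ∘ p) x∈ px)

  ∈-boolFilter⁻ : ∀ {x} → x ∈ boolFilter p xs → x ∈ xs × T (p x)
  ∈-boolFilter⁻ x∈ = ∈-filter⁻ (T? ∘ p) (subst (_ ∈_) (boolFilter≡filterᵇ p xs) x∈)

  boolFilter-unique : Unique xs → Unique (boolFilter p xs)
  boolFilter-unique u = subst Unique (sym (boolFilter≡filterᵇ p xs)) (Unique.filter⁺ (T? ∘ p) u)

module _ {A B : Set} (f : A → List B) where

  ∈-concatMap⁺ : ∀ {x y xs} → x ∈ xs → y ∈ f x → y ∈ concatMap f xs
  ∈-concatMap⁺ (here refl) y∈ = ∈-++⁺ˡ y∈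
  ∈-concatMap⁺ {xs = x ∷ xs} (there x∈) y∈ = ∈-++⁺ʳ (f x) (∈-concatMap⁺ x∈ y∈)

  ∈-concatMap⁻ : ∀ {y} xs → y ∈ concatMap f xs → ∃ λ x → x ∈ xs × y ∈ f x
  ∈-concatMap⁻ (x ∷ xs) y∈ with ∈-++⁻ (f x) y∈
  ... | inj₁ y∈fx = x , here refl , y∈fx
  ... | inj₂ y∈rest with ∈-concatMap⁻ xs y∈rest
  ...   | x′ , x′∈ , y∈fx′ = x′ , there x′∈ , y∈fx′

  concatMap-unique : (g : B → A) → (∀ {x y} → y ∈ f x → g y ≡ x) →
                     (∀ x → Unique (f x)) → ∀ {xs} → Unique xs → Unique (concatMap f xs)
  concatMap-unique g g-inv f-unique [] = []
  concatMap-unique g g-inv f-unique {x ∷ xs} (x∉xs ∷ xs-unique) =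
    Unique.++⁺ (f-unique x) (concatMap-unique g g-inv f-unique xs-unique) disjoint
    where
    disjoint : ∀ {y} → ¬ (y ∈ f x × y ∈ concatMap f xs)
    disjoint (y∈fx , y∈rest) with ∈-concatMap⁻ xs y∈rest
    ... | x′ , x′∈xs , y∈fx′ =
      All.lookup x∉xs x′∈xs (trans (sym (g-inv y∈fx)) (g-inv y∈fx′))

module _ {A : Set} (p : A → Bool) where

  boolFilter-++ : ∀ xs ys → boolFilter p (xs ++ ys) ≡ boolFilter p xs ++ boolFilter p ys
  boolFilter-++ []       ys = refl
  boolFilter-++ (x ∷ xs) ys with p x
  ... | true  = cong (x ∷_) (boolFilter-++ xs ys)
  ... | false = boolFilter-++ xs ys

  boolFilter-map : ∀ {B : Set} (f : B → A) xs → boolFilter p (map f xs) ≡ map f (boolFilter (p ∘ f) xs)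
  boolFilter-map f []       = refl
  boolFilter-map f (x ∷ xs) with p (f x)
  ... | true  = cong (f x ∷_) (boolFilter-map f xs)
  ... | false = boolFilter-map f xs

length-boolFilter-pairs : ∀ {A B : Set} (q : A × B → Bool) us vs →
  length (boolFilter q (concatMap (λ u → map (u ,_) vs) us)) ≡
  sum (map (λ u → length (boolFilter (λ v → q (u , v)) vs)) us)
length-boolFilter-pairs q []       vs = refl
length-boolFilter-pairs q (u ∷ us) vs = begin
  length (boolFilter q (map (u ,_) vs ++ rest))
    ≡⟨ cong length (boolFilter-++ q (map (u ,_) vs) rest) ⟩
  length (boolFilter q (map (u ,_) vs) ++ boolFilter q rest)
    ≡⟨ List.length-++ (boolFilter q (map (u ,_) vs)) ⟩
  length (boolFilter q (map (u ,_) vs)) + length (boolFilter q rest)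
    ≡⟨ cong₂ _+_ (trans (cong length (boolFilter-map q (u ,_) vs))
                        (List.length-map (u ,_) (boolFilter (q ∘ (u ,_)) vs)))
                 (length-boolFilter-pairs q us vs) ⟩
  length (boolFilter (λ v → q (u , v)) vs) + sum (map (λ u → length (boolFilter (λ v → q (u , v)) vs)) us) ∎
  where
  open ≡-Reasoning
  rest = concatMap (λ u → map (u ,_) vs) us

unique-↭ : ∀ {A : Set} {xs ys : List A} → Unique xs → Unique ys →
           (∀ {x} → x ∈ xs → x ∈ ys) → (∀ {x} → x ∈ ys → x ∈ xs) → xs ↭ ys
unique-↭ xs-unique ys-unique to from = ∼bag⇒↭ (unique∧set⇒bag xs-unique ys-unique (mk⇔ to from))

∈-fromMaybe⁻ : ∀ {A : Set} {x : A} {m} → x ∈ fromMaybe m → m ≡ just x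
∈-fromMaybe⁻ {m = just _} (here refl) = refl

fromMaybe-unique : ∀ {A : Set} (m : Maybe A) → Unique (fromMaybe m)
fromMaybe-unique nothing  = []
fromMaybe-unique (just _) = [] ∷ []

map-fromMaybe : ∀ {A B : Set} (f : A → B) m → map f (fromMaybe m) ≡ fromMaybe (Maybe.map f m)
map-fromMaybe f nothing  = refl
map-fromMaybe f (just _) = refl

module _ {A : Set} where

  sum-map-+ : ∀ (f g : A → ℕ) xs → sum (map (λ x → f x + g x) xs) ≡ sum (map f xs) + sum (map g xs)
  sum-map-+ f g []       = refl
  sum-map-+ f g (x ∷ xs) = trans (cong (_+_ (f x + g x)) (sum-map-+ f g xs)) (interchange (f x) (g x) _ _)
    where
    interchange : ∀ a b c d → a + b + (c + d) ≡ a + c + (b + d)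
    interchange = solve-∀

  sum-map-0 : ∀ (xs : List A) → sum (map (λ _ → 0) xs) ≡ 0
  sum-map-0 []       = refl
  sum-map-0 (_ ∷ xs) = sum-map-0 xs

  sum-map-1 : ∀ (xs : List A) → sum (map (λ _ → 1) xs) ≡ length xs
  sum-map-1 []       = refl
  sum-map-1 (_ ∷ xs) = cong suc (sum-map-1 xs)

  ≤-sum-map : ∀ (f : A → ℕ) {x xs} → x ∈ xs → f x ≤ sum (map f xs)
  ≤-sum-map f (here refl)             = ℕ.m≤m+n _ _
  ≤-sum-map f {xs = y ∷ _} (there x∈) = ℕ.≤-trans (≤-sum-map f x∈) (ℕ.m≤n+m _ (f y))

double-suc : ∀ a → 2 * suc a ≡ 2 * a + 2
double-suc a = trans (ℕ.*-suc 2 a) (ℕ.+-comm 2 (2 * a))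

odd-digit : ∀ a k (d : Digit) → 2 * a + toℕ d ≡ 2 * k + 1 → d ≡ d1 × a ≡ k
odd-digit a k d0 eq = ⊥-elim (ℕ.even≢odd a k (begin
  2 * a         ≡⟨ ℕ.+-identityʳ (2 * a) ⟨
  2 * a + 0     ≡⟨ eq ⟩
  2 * k + 1     ≡⟨ ℕ.+-comm (2 * k) 1 ⟩
  suc (2 * k)   ∎))
  where open ≡-Reasoning
odd-digit a k d1 eq = refl , ℕ.*-cancelˡ-≡ a k 2 (ℕ.+-cancelʳ-≡ 1 (2 * a) (2 * k) eq)
odd-digit a k d2 eq = ⊥-elim (ℕ.even≢odd (suc a) k (begin
  2 * suc a     ≡⟨ double-suc a ⟩
  2 * a + 2     ≡⟨ eq ⟩
  2 * k + 1     ≡⟨ ℕ.+-comm (2 * k) 1 ⟩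
  suc (2 * k)   ∎))
  where open ≡-Reasoning

even-digit : ∀ a k (d : Digit) → 2 * a + toℕ d ≡ 2 * k + 2 → (d ≡ d0 × a ≡ suc k) ⊎ (d ≡ d2 × a ≡ k)
even-digit a k d0 eq =
  inj₁ (refl , ℕ.*-cancelˡ-≡ a (suc k) 2 (trans (sym (ℕ.+-identityʳ (2 * a))) (trans eq (sym (double-suc k)))))
even-digit a k d1 eq = ⊥-elim (ℕ.even≢odd (suc k) a (sym (trans (ℕ.+-comm 1 (2 * a)) (trans eq (sym (double-suc k))))))
even-digit a k d2 eq = inj₂ (refl , ℕ.*-cancelˡ-≡ a k 2 (ℕ.+-cancelʳ-≡ 2 (2 * a) (2 * k) eq))

data Halving : ℕ → Set where
  zero : Halving 0
  odd  : ∀ k → Halving (2 * k + 1)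
  even : ∀ k → Halving (2 * k + 2)

halving : ∀ n → Halving n
halving zero = zero
halving (suc n) with halving n
... | zero   = odd 0
... | odd k  = subst Halving (ℕ.+-suc (2 * k) 1) (even k)
... | even k = subst Halving (trans (cong (_+ 1) (double-suc k)) (ℕ.+-comm (2 * k + 2) 1)) (odd (suc k))

halving-induction : (P : ℕ → Set) → P 0 → (∀ k → P k → P (2 * k + 1)) →
                    (∀ k → P (suc k) → P k → P (2 * k + 2)) → ∀ n → P n
halving-induction P base odd-step even-step = <-rec P step
  where
  k<2k+1 : ∀ k → k < 2 * k + 1
  k<2k+1 k = ℕ.≤-trans (s≤s (ℕ.m≤m+n k (k + 0))) (ℕ.≤-reflexive (ℕ.+-comm 1 (2 * k)))
  1+k<2k+2 : ∀ k → suc k < 2 * k + 2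
  1+k<2k+2 k = ℕ.≤-trans (s≤s (s≤s (ℕ.m≤m+n k (k + 0)))) (ℕ.≤-reflexive (ℕ.+-comm 2 (2 * k)))
  step : ∀ n → (∀ {m} → m < n → P m) → P n
  step n ih with halving n
  ... | zero   = base
  ... | odd k  = odd-step k (ih (k<2k+1 k))
  ... | even k = even-step k (ih (1+k<2k+2 k)) (ih (ℕ.<-trans (ℕ.n<1+n k) (1+k<2k+2 k)))

extensions : Word → List Word
extensions w = (d0 ∷ w) ∷ (d1 ∷ w) ∷ (d2 ∷ w) ∷ []

extensions-unique : ∀ w → Unique (extensions w)
extensions-unique w = ((λ ()) ∷ (λ ()) ∷ []) ∷ ((λ ()) ∷ []) ∷ [] ∷ []

∈-extensions⁺ : ∀ a w → (a ∷ w) ∈ extensions w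
∈-extensions⁺ d0 w = here refl
∈-extensions⁺ d1 w = there (here refl)
∈-extensions⁺ d2 w = there (there (here refl))

∈-extensions⁻ : ∀ {w y} → y ∈ extensions w → drop 1 y ≡ w × length y ≡ suc (length w)
∈-extensions⁻ (here refl)                 = refl , refl
∈-extensions⁻ (there (here refl))         = refl , refl
∈-extensions⁻ (there (there (here refl))) = refl , refl

wordsOfLen-length : ∀ L {w} → w ∈ wordsOfLen L → length w ≡ L
wordsOfLen-length zero (here refl) = refl
wordsOfLen-length (suc L) w∈ with ∈-concatMap⁻ extensions (wordsOfLen L) w∈
... | x , x∈ , w∈ext = trans (proj₂ (∈-extensions⁻ w∈ext)) (cong suc (wordsOfLen-length L x∈))

∈-wordsOfLen : ∀ w → w ∈ wordsOfLen (length w)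
∈-wordsOfLen []      = here refl
∈-wordsOfLen (a ∷ w) = ∈-concatMap⁺ extensions (∈-wordsOfLen w) (∈-extensions⁺ a w)

wordsOfLen-unique : ∀ L → Unique (wordsOfLen L)
wordsOfLen-unique zero    = [] ∷ []
wordsOfLen-unique (suc L) =
  concatMap-unique extensions (drop 1) (proj₁ ∘ ∈-extensions⁻) extensions-unique (wordsOfLen-unique L)

∈-wordsUpTo : ∀ {L w} → length w ≤ L → w ∈ wordsUpTo L
∈-wordsUpTo {w = w} |w|≤L = ∈-concatMap⁺ wordsOfLen (∈-upTo⁺ (s≤s |w|≤L)) (∈-wordsOfLen w)

wordsUpTo-unique : ∀ L → Unique (wordsUpTo L)
wordsUpTo-unique L =
  concatMap-unique wordsOfLen length (wordsOfLen-length _) wordsOfLen-unique (Unique.upTo⁺ (suc L))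

Hyperbinary : ℕ → Word → Set
Hyperbinary n w = T (leadOK w) × value w ≡ n

pushDigit : ℕ → Digit → ℕ
pushDigit acc d = 2 * acc + toℕ d

value-∷ʳ : ∀ w d → value (w ∷ʳ d) ≡ 2 * value w + toℕ d
value-∷ʳ w d = List.foldl-∷ʳ _ 0 d w

foldl-pushDigit-≥ : ∀ acc w → acc * 2 ^ length w ≤ foldl pushDigit acc w
foldl-pushDigit-≥ acc []      = ℕ.≤-reflexive (ℕ.*-identityʳ acc)
foldl-pushDigit-≥ acc (d ∷ w) = begin
  acc * (2 * 2 ^ length w)       ≡⟨ ℕ.*-assoc acc 2 _ ⟨
  acc * 2 * 2 ^ length w         ≡⟨ cong (_* 2 ^ length w) (ℕ.*-comm acc 2) ⟩
  2 * acc * 2 ^ length w         ≤⟨ ℕ.*-monoˡ-≤ (2 ^ length w) (ℕ.m≤m+n (2 * acc) (toℕ d)) ⟩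
  (2 * acc + toℕ d) * 2 ^ length w ≤⟨ foldl-pushDigit-≥ (2 * acc + toℕ d) w ⟩
  foldl pushDigit (2 * acc + toℕ d) w ∎
  where open ℕ.≤-Reasoning

2^length≤value : ∀ a w → T (leadOK (a ∷ w)) → 2 ^ length w ≤ value (a ∷ w)
2^length≤value d1 w _ = ℕ.≤-trans (ℕ.≤-reflexive (sym (ℕ.*-identityˡ _))) (foldl-pushDigit-≥ 1 w)
2^length≤value d2 w _ = ℕ.≤-trans (ℕ.m≤m+n (2 ^ length w) _) (foldl-pushDigit-≥ 2 w)

length≤1+⌊log₂⌋ : ∀ {n} w → Hyperbinary n w → length w ≤ suc ⌊log₂ n ⌋
length≤1+⌊log₂⌋ []      _           = z≤n
length≤1+⌊log₂⌋ (a ∷ w) (lead , refl) =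
  s≤s (subst (_≤ ⌊log₂ value (a ∷ w) ⌋) (⌊log₂[2^n]⌋≡n (length w))
             (⌊log₂⌋-mono-≤ (2^length≤value a w lead)))

∈-H⁺ : ∀ {n w} → Hyperbinary n w → w ∈ H n
∈-H⁺ {n} {w} hyp@(lead , val) =
  ∈-boolFilter⁺ (isHyper n) {wordsUpTo (suc ⌊log₂ n ⌋)} (∈-wordsUpTo (length≤1+⌊log₂⌋ w hyp))
    (Equivalence.from T-∧ (lead , fromWitness val))

∈-H⁻ : ∀ n {w} → w ∈ H n → Hyperbinary n w
∈-H⁻ n w∈ with Equivalence.to T-∧ (proj₂ (∈-boolFilter⁻ (isHyper n) {wordsUpTo (suc ⌊log₂ n ⌋)} w∈))
... | lead , val = lead , toWitness val

H-unique : ∀ n → Unique (H n)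
H-unique n = boolFilter-unique (isHyper n) (wordsUpTo-unique (suc ⌊log₂ n ⌋))

leadOK-head : ∀ a v w → leadOK (a ∷ v) ≡ leadOK (a ∷ w)
leadOK-head d0 v w = refl
leadOK-head d1 v w = refl
leadOK-head d2 v w = refl

leadOK-∷ʳ⁻ : ∀ i d → T (leadOK (i ∷ʳ d)) → T (leadOK i)
leadOK-∷ʳ⁻ []      d _    = _
leadOK-∷ʳ⁻ (a ∷ r) d lead = subst T (leadOK-head a (r ∷ʳ d) r) lead

-- The side condition excludes [] ∷ʳ d0, which has a leading zero.
∈-H-∷ʳ⁺ : ∀ m {i} d → i ∈ H m → (i ≡ [] → T (leadOK [ d ])) → (i ∷ʳ d) ∈ H (2 * m + toℕ d)
∈-H-∷ʳ⁺ m {[]}    d i∈ lead[] with refl ← proj₂ (∈-H⁻ m i∈) = ∈-H⁺ (lead[] refl , refl)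
∈-H-∷ʳ⁺ m {a ∷ r} d i∈ _ with lead , refl ← ∈-H⁻ m i∈ =
  ∈-H⁺ (subst T (leadOK-head a r (r ∷ʳ d)) lead , value-∷ʳ (a ∷ r) d)

∈-H-∷ʳ⁻ : ∀ n i d → (i ∷ʳ d) ∈ H n → 2 * value i + toℕ d ≡ n × T (leadOK i)
∈-H-∷ʳ⁻ n i d w∈ with lead , val ← ∈-H⁻ n w∈ = trans (sym (value-∷ʳ i d)) val , leadOK-∷ʳ⁻ i d lead

H-odd : ∀ k → H (2 * k + 1) ↭ map (_∷ʳ d1) (H k)
H-odd k = unique-↭ (H-unique (2 * k + 1)) (Unique.map⁺ (List.∷ʳ-injectiveˡ _ _) (H-unique k)) to from
  where
  to : ∀ {w} → w ∈ H (2 * k + 1) → w ∈ map (_∷ʳ d1) (H k)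
  to {w} w∈ with reverseView w
  ... | [] = ⊥-elim (ℕ.0≢1+n (trans (proj₂ (∈-H⁻ (2 * k + 1) w∈)) (ℕ.+-comm (2 * k) 1)))
  ... | i ∶ _ ∶ʳ d with val , lead ← ∈-H-∷ʳ⁻ _ i d w∈ with refl , refl ← odd-digit (value i) k d val =
    ∈-map⁺ (_∷ʳ d1) (∈-H⁺ (lead , refl))
  from : ∀ {w} → w ∈ map (_∷ʳ d1) (H k) → w ∈ H (2 * k + 1)
  from w∈ with i , i∈ , refl ← ∈-map⁻ (_∷ʳ d1) w∈ = ∈-H-∷ʳ⁺ k d1 i∈ (λ _ → _)

H-even : ∀ k → H (2 * k + 2) ↭ map (_∷ʳ d0) (H (suc k)) ++ map (_∷ʳ d2) (H k)
H-even k = unique-↭ (H-unique (2 * k + 2)) rhs-unique to from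
  where
  rhs-unique : Unique (map (_∷ʳ d0) (H (suc k)) ++ map (_∷ʳ d2) (H k))
  rhs-unique = Unique.++⁺ (Unique.map⁺ (List.∷ʳ-injectiveˡ _ _) (H-unique (suc k)))
                          (Unique.map⁺ (List.∷ʳ-injectiveˡ _ _) (H-unique k)) disjoint
    where
    disjoint : ∀ {w} → ¬ (w ∈ map (_∷ʳ d0) (H (suc k)) × w ∈ map (_∷ʳ d2) (H k))
    disjoint (w∈₀ , w∈₂) with i , _ , refl ← ∈-map⁻ (_∷ʳ d0) w∈₀ | j , _ , eq ← ∈-map⁻ (_∷ʳ d2) w∈₂
      with () ← List.∷ʳ-injectiveʳ i j eq
  to : ∀ {w} → w ∈ H (2 * k + 2) → w ∈ map (_∷ʳ d0) (H (suc k)) ++ map (_∷ʳ d2) (H k)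
  to {w} w∈ with reverseView w
  ... | [] = ⊥-elim (ℕ.0≢1+n (trans (proj₂ (∈-H⁻ (2 * k + 2) w∈)) (ℕ.+-comm (2 * k) 2)))
  ... | i ∶ _ ∶ʳ d with val , lead ← ∈-H-∷ʳ⁻ _ i d w∈ with even-digit (value i) k d val
  ...   | inj₁ (refl , val₀) = ∈-++⁺ˡ (∈-map⁺ (_∷ʳ d0) (∈-H⁺ (lead , val₀)))
  ...   | inj₂ (refl , val₂) = ∈-++⁺ʳ _ (∈-map⁺ (_∷ʳ d2) (∈-H⁺ (lead , val₂)))
  from : ∀ {w} → w ∈ map (_∷ʳ d0) (H (suc k)) ++ map (_∷ʳ d2) (H k) → w ∈ H (2 * k + 2)
  from w∈ with ∈-++⁻ (map (_∷ʳ d0) (H (suc k))) w∈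
  ... | inj₁ w∈₀ with i , i∈ , refl ← ∈-map⁻ (_∷ʳ d0) w∈₀ =
    subst (λ n → (i ∷ʳ d0) ∈ H n) (trans (ℕ.+-identityʳ (2 * suc k)) (double-suc k))
      (∈-H-∷ʳ⁺ (suc k) d0 i∈ λ { refl → ⊥-elim (ℕ.0≢1+n (proj₂ (∈-H⁻ (suc k) i∈))) })
  ... | inj₂ w∈₂ with i , i∈ , refl ← ∈-map⁻ (_∷ʳ d2) w∈₂ =
    ∈-H-∷ʳ⁺ k d2 i∈ (λ _ → _)

∈-H-odd⁻ : ∀ k {w} → w ∈ H (2 * k + 1) → ∃ λ i → i ∈ H k × w ≡ i ∷ʳ d1
∈-H-odd⁻ k w∈ = ∈-map⁻ (_∷ʳ d1) (↭.∈-resp-↭ (H-odd k) w∈)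

∈-H-odd⁺ : ∀ k {i} → i ∈ H k → (i ∷ʳ d1) ∈ H (2 * k + 1)
∈-H-odd⁺ k i∈ = ↭.∈-resp-↭ (↭-sym (H-odd k)) (∈-map⁺ (_∷ʳ d1) i∈)

EvenSplit : ℕ → Word → Set
EvenSplit k w = (∃ λ i → i ∈ H (suc k) × w ≡ i ∷ʳ d0) ⊎ (∃ λ i → i ∈ H k × w ≡ i ∷ʳ d2)

∈-H-even⁻ : ∀ k {w} → w ∈ H (2 * k + 2) → EvenSplit k w
∈-H-even⁻ k w∈ with ∈-++⁻ (map (_∷ʳ d0) (H (suc k))) (↭.∈-resp-↭ (H-even k) w∈)
... | inj₁ w∈₀ = inj₁ (∈-map⁻ (_∷ʳ d0) w∈₀)
... | inj₂ w∈₂ = inj₂ (∈-map⁻ (_∷ʳ d2) w∈₂)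

∈-H-even₀⁺ : ∀ k {i} → i ∈ H (suc k) → (i ∷ʳ d0) ∈ H (2 * k + 2)
∈-H-even₀⁺ k i∈ = ↭.∈-resp-↭ (↭-sym (H-even k)) (∈-++⁺ˡ (∈-map⁺ (_∷ʳ d0) i∈))

∈-H-even₂⁺ : ∀ k {i} → i ∈ H k → (i ∷ʳ d2) ∈ H (2 * k + 2)
∈-H-even₂⁺ k i∈ = ↭.∈-resp-↭ (↭-sym (H-even k)) (∈-++⁺ʳ _ (∈-map⁺ (_∷ʳ d2) i∈))

∈-H-even₀⁻ : ∀ k {i} → (i ∷ʳ d0) ∈ H (2 * k + 2) → i ∈ H (suc k)
∈-H-even₀⁻ k {i} w∈ with ∈-H-even⁻ k w∈
... | inj₁ (j , j∈ , eq) = subst (_∈ H (suc k)) (sym (List.∷ʳ-injectiveˡ i j eq)) j∈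
... | inj₂ (j , _ , eq) with () ← List.∷ʳ-injectiveʳ i j eq

binary-expansion : ∀ n → ∃ λ b → b ∈ H n × All (_≢ d2) b
binary-expansion = halving-induction _ ([] , here refl , [])
  (λ k (b , b∈ , b-binary) → b ∷ʳ d1 , ∈-H-odd⁺ k b∈ , All.∷ʳ⁺ b-binary (λ ()))
  (λ k (b , b∈ , b-binary) _ → b ∷ʳ d0 , ∈-H-even₀⁺ k b∈ , All.∷ʳ⁺ b-binary (λ ()))

leadingRewrite : Word → Maybe Word
leadingRewrite (d2 ∷ y) = just (d1 ∷ d0 ∷ y)
leadingRewrite _        = nothing

localRewrite : Word → Maybe Word
localRewrite (d0 ∷ d2 ∷ y) = just (d1 ∷ d0 ∷ y)
localRewrite (d1 ∷ d2 ∷ y) = just (d2 ∷ d0 ∷ y)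
localRewrite _             = nothing

innerRewrites : Word → List Word
innerRewrites []      = []
innerRewrites (a ∷ w) = fromMaybe (localRewrite (a ∷ w)) ++ map (a ∷_) (innerRewrites w)

-- `rewrites` is defined through a where-bound helper `inner`, which Agda does not export; it is lifted
-- to a function that also takes the whole word. `innerOf` names it: the with-abstraction below turns
-- its arguments into variables, so that unification can solve the metavariable.
mutual
  innerOf : Word → Word → List Word
  innerOf = _

  private
    innerOf-solution : ∀ a y → rewrites (a ∷ y) ≡ rewrites (a ∷ y)
    innerOf-solution a y with a ∷ y | _++_ {A = Word} | map {A = Word} {B = Word}
    ... | u | _++′_ | map′ = refl {x = _ ++′ (_ ++′ map′ (a ∷_) (innerOf u y))}

innerOf-∷ : ∀ u a w → innerOf u (a ∷ w) ≡ fromMaybe (localRewrite (a ∷ w)) ++ map (a ∷_) (innerOf u w)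
innerOf-∷ u d0 []          = refl
innerOf-∷ u d0 (d0 ∷ w)    = refl
innerOf-∷ u d0 (d1 ∷ w)    = refl
innerOf-∷ u d0 (d2 ∷ w)    = refl
innerOf-∷ u d1 []          = refl
innerOf-∷ u d1 (d0 ∷ w)    = refl
innerOf-∷ u d1 (d1 ∷ w)    = refl
innerOf-∷ u d1 (d2 ∷ w)    = refl
innerOf-∷ u d2 w           = refl

innerOf≡innerRewrites : ∀ u w → innerOf u w ≡ innerRewrites w
innerOf≡innerRewrites u []      = refl
innerOf≡innerRewrites u (a ∷ w) =
  trans (innerOf-∷ u a w) (cong (λ t → fromMaybe (localRewrite (a ∷ w)) ++ map (a ∷_) t) (innerOf≡innerRewrites u w))

rewrites≡ : ∀ u → rewrites u ≡ fromMaybe (leadingRewrite u) ++ innerRewrites u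
rewrites≡ []       = refl
rewrites≡ (d0 ∷ y) = innerOf≡innerRewrites (d0 ∷ y) (d0 ∷ y)
rewrites≡ (d1 ∷ y) = innerOf≡innerRewrites (d1 ∷ y) (d1 ∷ y)
rewrites≡ (d2 ∷ y) = cong ((d1 ∷ d0 ∷ y) ∷_) (innerOf≡innerRewrites (d2 ∷ y) (d2 ∷ y))

localRewrite-foldl : ∀ acc u {w} → localRewrite u ≡ just w → foldl pushDigit acc w ≡ foldl pushDigit acc u
localRewrite-foldl acc (d0 ∷ d2 ∷ y) refl = cong (λ t → foldl pushDigit t y) (carry acc)
  where
  carry : ∀ a → 2 * (2 * a + 1) + 0 ≡ 2 * (2 * a + 0) + 2
  carry = solve-∀
localRewrite-foldl acc (d1 ∷ d2 ∷ y) refl = cong (λ t → foldl pushDigit t y) (carry acc)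
  where
  carry : ∀ a → 2 * (2 * a + 2) + 0 ≡ 2 * (2 * a + 1) + 2
  carry = solve-∀

innerRewrites-foldl : ∀ acc u {w} → w ∈ innerRewrites u → foldl pushDigit acc w ≡ foldl pushDigit acc u
innerRewrites-foldl acc (a ∷ u) w∈ with ∈-++⁻ (fromMaybe (localRewrite (a ∷ u))) w∈
... | inj₁ w∈local = localRewrite-foldl acc (a ∷ u) (∈-fromMaybe⁻ w∈local)
... | inj₂ w∈map with v , v∈ , refl ← ∈-map⁻ (a ∷_) w∈map = innerRewrites-foldl (pushDigit acc a) u v∈

rewrites-value : ∀ u {w} → w ∈ rewrites u → value w ≡ value u
rewrites-value u w∈ with ∈-++⁻ (fromMaybe (leadingRewrite u)) (subst (_ ∈_) (rewrites≡ u) w∈)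
rewrites-value (d2 ∷ y) w∈ | inj₁ (here refl) = refl
... | inj₂ w∈inner = innerRewrites-foldl 0 u w∈inner

rewrites-leadOK : ∀ u {w} → T (leadOK u) → w ∈ rewrites u → T (leadOK w)
rewrites-leadOK u lead w∈ with ∈-++⁻ (fromMaybe (leadingRewrite u)) (subst (_ ∈_) (rewrites≡ u) w∈)
rewrites-leadOK (d2 ∷ y) lead w∈ | inj₁ (here refl) = _
rewrites-leadOK (a ∷ u) lead w∈ | inj₂ w∈inner with ∈-++⁻ (fromMaybe (localRewrite (a ∷ u))) w∈inner
rewrites-leadOK (d1 ∷ d2 ∷ y) lead w∈ | inj₂ _ | inj₁ (here refl) = _
... | inj₂ w∈map with v , _ , refl ← ∈-map⁻ (a ∷_) w∈map = subst T (leadOK-head a u v) lead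

∈-rewrites-H : ∀ n {u w} → u ∈ H n → w ∈ rewrites u → w ∈ H n
∈-rewrites-H n {u} u∈ w∈ with lead , val ← ∈-H⁻ n u∈ =
  ∈-H⁺ (rewrites-leadOK u lead w∈ , trans (rewrites-value u w∈) val)

leadingRewrite-length : ∀ u {w} → leadingRewrite u ≡ just w → length w ≡ suc (length u)
leadingRewrite-length (d2 ∷ y) refl = refl

localRewrite-length : ∀ u {w} → localRewrite u ≡ just w → length w ≡ length u
localRewrite-length (d0 ∷ d2 ∷ y) refl = refl
localRewrite-length (d1 ∷ d2 ∷ y) refl = refl

innerRewrites-length : ∀ u {w} → w ∈ innerRewrites u → length w ≡ length u
innerRewrites-length (a ∷ u) w∈ with ∈-++⁻ (fromMaybe (localRewrite (a ∷ u))) w∈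
... | inj₁ w∈local = localRewrite-length (a ∷ u) (∈-fromMaybe⁻ w∈local)
... | inj₂ w∈map with v , v∈ , refl ← ∈-map⁻ (a ∷_) w∈map = cong suc (innerRewrites-length u v∈)

localRewrite-changes-head : ∀ a u {w} → localRewrite (a ∷ u) ≡ just w → ∀ v → w ≢ a ∷ v
localRewrite-changes-head d0 (d2 ∷ y) refl v ()
localRewrite-changes-head d1 (d2 ∷ y) refl v ()

innerRewrites-unique : ∀ u → Unique (innerRewrites u)
innerRewrites-unique []      = []
innerRewrites-unique (a ∷ u) =
  Unique.++⁺ (fromMaybe-unique _) (Unique.map⁺ (λ { refl → refl }) (innerRewrites-unique u)) disjoint
  where
  disjoint : ∀ {w} → ¬ (w ∈ fromMaybe (localRewrite (a ∷ u)) × w ∈ map (a ∷_) (innerRewrites u))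
  disjoint (w∈local , w∈map) with v , _ , w≡ ← ∈-map⁻ (a ∷_) w∈map =
    localRewrite-changes-head a u (∈-fromMaybe⁻ w∈local) v w≡

rewrites-unique : ∀ u → Unique (rewrites u)
rewrites-unique u = subst Unique (sym (rewrites≡ u))
  (Unique.++⁺ (fromMaybe-unique _) (innerRewrites-unique u) disjoint)
  where
  disjoint : ∀ {w} → ¬ (w ∈ fromMaybe (leadingRewrite u) × w ∈ innerRewrites u)
  disjoint (w∈leading , w∈inner) = ℕ.1+n≢n
    (trans (sym (leadingRewrite-length u (∈-fromMaybe⁻ w∈leading))) (innerRewrites-length u w∈inner))

boundaryRewrite : Word → Digit → Maybe Word
boundaryRewrite []          d = leadingRewrite [ d ]
boundaryRewrite (a ∷ [])    d = localRewrite (a ∷ d ∷ [])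
boundaryRewrite (a ∷ b ∷ w) d = Maybe.map (a ∷_) (boundaryRewrite (b ∷ w) d)

localRewrite-[_] : ∀ a → localRewrite [ a ] ≡ nothing
localRewrite-[ d0 ] = refl
localRewrite-[ d1 ] = refl
localRewrite-[ d2 ] = refl

localRewrite-∷ʳ : ∀ a b w d →
                  localRewrite (a ∷ b ∷ w ∷ʳ d) ≡ Maybe.map (_∷ʳ d) (localRewrite (a ∷ b ∷ w))
localRewrite-∷ʳ d0 d0 w d = refl
localRewrite-∷ʳ d0 d1 w d = refl
localRewrite-∷ʳ d0 d2 w d = refl
localRewrite-∷ʳ d1 d0 w d = refl
localRewrite-∷ʳ d1 d1 w d = refl
localRewrite-∷ʳ d1 d2 w d = refl
localRewrite-∷ʳ d2 b  w d = refl

leadingRewrite-∷ʳ : ∀ a w d → leadingRewrite (a ∷ w ∷ʳ d) ≡ Maybe.map (_∷ʳ d) (leadingRewrite (a ∷ w))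
leadingRewrite-∷ʳ d0 w d = refl
leadingRewrite-∷ʳ d1 w d = refl
leadingRewrite-∷ʳ d2 w d = refl

map-∷-∷ʳ : ∀ (a d : Digit) ws → map (_∷ʳ d) (map (a ∷_) ws) ≡ map (a ∷_) (map (_∷ʳ d) ws)
map-∷-∷ʳ a d ws = trans (sym (List.map-∘ ws)) (List.map-∘ ws)

innerRewrites-∷ʳ : ∀ a w d →
  innerRewrites (a ∷ w ∷ʳ d) ≡ map (_∷ʳ d) (innerRewrites (a ∷ w)) ++ fromMaybe (boundaryRewrite (a ∷ w) d)
innerRewrites-∷ʳ a [] d rewrite localRewrite-[ a ] | localRewrite-[ d ] = List.++-identityʳ _
innerRewrites-∷ʳ a (b ∷ w) d = begin
  fromMaybe (localRewrite (a ∷ b ∷ w ∷ʳ d)) ++ map (a ∷_) (innerRewrites (b ∷ w ∷ʳ d))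
    ≡⟨ cong₂ _++_ (cong fromMaybe (localRewrite-∷ʳ a b w d)) (cong (map (a ∷_)) (innerRewrites-∷ʳ b w d)) ⟩
  fromMaybe (Maybe.map (_∷ʳ d) L) ++ map (a ∷_) (map (_∷ʳ d) I ++ fromMaybe B)
    ≡⟨ cong₂ _++_ (sym (map-fromMaybe (_∷ʳ d) L)) (List.map-++ (a ∷_) (map (_∷ʳ d) I) (fromMaybe B)) ⟩
  map (_∷ʳ d) (fromMaybe L) ++ (map (a ∷_) (map (_∷ʳ d) I) ++ map (a ∷_) (fromMaybe B))
    ≡⟨ cong (λ t → map (_∷ʳ d) (fromMaybe L) ++ (t ++ map (a ∷_) (fromMaybe B))) (sym (map-∷-∷ʳ a d I)) ⟩
  map (_∷ʳ d) (fromMaybe L) ++ (map (_∷ʳ d) (map (a ∷_) I) ++ map (a ∷_) (fromMaybe B))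
    ≡⟨ List.++-assoc (map (_∷ʳ d) (fromMaybe L)) _ _ ⟨
  (map (_∷ʳ d) (fromMaybe L) ++ map (_∷ʳ d) (map (a ∷_) I)) ++ map (a ∷_) (fromMaybe B)
    ≡⟨ cong₂ _++_ (sym (List.map-++ (_∷ʳ d) (fromMaybe L) _)) (map-fromMaybe (a ∷_) B) ⟩
  map (_∷ʳ d) (innerRewrites (a ∷ b ∷ w)) ++ fromMaybe (boundaryRewrite (a ∷ b ∷ w) d) ∎
  where
  open ≡-Reasoning
  L = localRewrite (a ∷ b ∷ w)
  I = innerRewrites (b ∷ w)
  B = boundaryRewrite (b ∷ w) d

rewrites-∷ʳ : ∀ w d → rewrites (w ∷ʳ d) ≡ map (_∷ʳ d) (rewrites w) ++ fromMaybe (boundaryRewrite w d)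
rewrites-∷ʳ []      d0 = refl
rewrites-∷ʳ []      d1 = refl
rewrites-∷ʳ []      d2 = refl
rewrites-∷ʳ (a ∷ w) d = begin
  rewrites (a ∷ w ∷ʳ d)
    ≡⟨ rewrites≡ (a ∷ w ∷ʳ d) ⟩
  fromMaybe (leadingRewrite (a ∷ w ∷ʳ d)) ++ innerRewrites (a ∷ w ∷ʳ d)
    ≡⟨ cong₂ _++_ (trans (cong fromMaybe (leadingRewrite-∷ʳ a w d))
                         (sym (map-fromMaybe (_∷ʳ d) (leadingRewrite (a ∷ w)))))
                  (innerRewrites-∷ʳ a w d) ⟩
  map (_∷ʳ d) (fromMaybe (leadingRewrite (a ∷ w))) ++ (map (_∷ʳ d) (innerRewrites (a ∷ w)) ++ B)
    ≡⟨ List.++-assoc (map (_∷ʳ d) (fromMaybe (leadingRewrite (a ∷ w)))) _ _ ⟨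
  (map (_∷ʳ d) (fromMaybe (leadingRewrite (a ∷ w))) ++ map (_∷ʳ d) (innerRewrites (a ∷ w))) ++ B
    ≡⟨ cong (_++ B) (sym (List.map-++ (_∷ʳ d) (fromMaybe (leadingRewrite (a ∷ w))) _)) ⟩
  map (_∷ʳ d) (fromMaybe (leadingRewrite (a ∷ w)) ++ innerRewrites (a ∷ w)) ++ B
    ≡⟨ cong (λ t → map (_∷ʳ d) t ++ B) (rewrites≡ (a ∷ w)) ⟨
  map (_∷ʳ d) (rewrites (a ∷ w)) ++ B ∎
  where
  open ≡-Reasoning
  B = fromMaybe (boundaryRewrite (a ∷ w) d)

increment : Digit → Maybe Digit
increment d0 = just d1
increment d1 = just d2
increment d2 = nothing

boundaryRewrite-∷ : ∀ a w e d → boundaryRewrite (a ∷ w ∷ʳ e) d ≡ Maybe.map (a ∷_) (boundaryRewrite (w ∷ʳ e) d)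
boundaryRewrite-∷ a []      e d = refl
boundaryRewrite-∷ a (b ∷ w) e d = refl

boundaryRewrite-∷ʳ : ∀ w e → boundaryRewrite (w ∷ʳ e) d2 ≡ Maybe.map (λ c → w ∷ʳ c ∷ʳ d0) (increment e)
boundaryRewrite-∷ʳ [] d0 = refl
boundaryRewrite-∷ʳ [] d1 = refl
boundaryRewrite-∷ʳ [] d2 = refl
boundaryRewrite-∷ʳ (a ∷ w) e = begin
  boundaryRewrite (a ∷ w ∷ʳ e) d2                           ≡⟨ boundaryRewrite-∷ a w e d2 ⟩
  Maybe.map (a ∷_) (boundaryRewrite (w ∷ʳ e) d2)            ≡⟨ cong (Maybe.map (a ∷_)) (boundaryRewrite-∷ʳ w e) ⟩
  Maybe.map (a ∷_) (Maybe.map (λ c → w ∷ʳ c ∷ʳ d0) (increment e)) ≡⟨ Maybe.map-∘ (increment e) ⟨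
  Maybe.map (λ c → a ∷ w ∷ʳ c ∷ʳ d0) (increment e)          ∎
  where open ≡-Reasoning

boundaryRewrite-≢2 : ∀ w d → d ≢ d2 → boundaryRewrite w d ≡ nothing
boundaryRewrite-≢2 w           d2 d≢2 = ⊥-elim (d≢2 refl)
boundaryRewrite-≢2 []          d0 _   = refl
boundaryRewrite-≢2 []          d1 _   = refl
boundaryRewrite-≢2 (d0 ∷ [])   d0 _   = refl
boundaryRewrite-≢2 (d0 ∷ [])   d1 _   = refl
boundaryRewrite-≢2 (d1 ∷ [])   d0 _   = refl
boundaryRewrite-≢2 (d1 ∷ [])   d1 _   = refl
boundaryRewrite-≢2 (d2 ∷ [])   d  _   = refl
boundaryRewrite-≢2 (a ∷ b ∷ w) d  d≢2 = cong (Maybe.map (a ∷_)) (boundaryRewrite-≢2 (b ∷ w) d d≢2)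

∈-rewrites-∷ʳ : ∀ u {w} d → w ∈ rewrites u → (w ∷ʳ d) ∈ rewrites (u ∷ʳ d)
∈-rewrites-∷ʳ u d w∈ = subst (_ ∈_) (sym (rewrites-∷ʳ u d)) (∈-++⁺ˡ (∈-map⁺ (_∷ʳ d) w∈))

∈-boundaryRewrite : ∀ w d {v} → boundaryRewrite w d ≡ just v → v ∈ rewrites (w ∷ʳ d)
∈-boundaryRewrite w d eq = subst (_ ∈_) (sym (rewrites-∷ʳ w d))
  (∈-++⁺ʳ (map (_∷ʳ d) (rewrites w)) (subst (λ m → _ ∈ fromMaybe m) (sym eq) (here refl)))

carry-boundary : ∀ {b} → All (_≢ d2) b → ∃ λ z → boundaryRewrite b d2 ≡ just (z ∷ʳ d0)
carry-boundary {b} b-binary with reverseView b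
... | [] = d1 ∷ [] , refl
... | i ∶ _ ∶ʳ e with e | proj₂ (All.∷ʳ⁻ b-binary)
...   | d0 | _   = i ∷ʳ d1 , boundaryRewrite-∷ʳ i d0
...   | d1 | _   = i ∷ʳ d2 , boundaryRewrite-∷ʳ i d1
...   | d2 | 2≢2 = ⊥-elim (2≢2 refl)

sumOverH : (Word → ℕ) → ℕ → ℕ
sumOverH f n = sum (map f (H n))

sumOverH-odd : ∀ f k → sumOverH f (2 * k + 1) ≡ sumOverH (f ∘ (_∷ʳ d1)) k
sumOverH-odd f k = trans (sum-↭ (↭.map⁺ f (H-odd k))) (cong sum (sym (List.map-∘ (H k))))

sumOverH-even : ∀ f k → sumOverH f (2 * k + 2) ≡ sumOverH (f ∘ (_∷ʳ d0)) (suc k) + sumOverH (f ∘ (_∷ʳ d2)) k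
sumOverH-even f k = begin
  sum (map f (H (2 * k + 2)))
    ≡⟨ sum-↭ (↭.map⁺ f (H-even k)) ⟩
  sum (map f (map (_∷ʳ d0) (H (suc k)) ++ map (_∷ʳ d2) (H k)))
    ≡⟨ cong sum (List.map-++ f (map (_∷ʳ d0) (H (suc k))) _) ⟩
  sum (map f (map (_∷ʳ d0) (H (suc k))) ++ map f (map (_∷ʳ d2) (H k)))
    ≡⟨ sum-++ (map f (map (_∷ʳ d0) (H (suc k)))) _ ⟩
  sum (map f (map (_∷ʳ d0) (H (suc k)))) + sum (map f (map (_∷ʳ d2) (H k)))
    ≡⟨ cong₂ _+_ (cong sum (List.map-∘ (H (suc k)))) (cong sum (List.map-∘ (H k))) ⟨
  sumOverH (f ∘ (_∷ʳ d0)) (suc k) + sumOverH (f ∘ (_∷ʳ d2)) k ∎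
  where open ≡-Reasoning

sumOverH-cong : ∀ {f g} → (∀ w → f w ≡ g w) → ∀ n → sumOverH f n ≡ sumOverH g n
sumOverH-cong f≗g n = cong sum (List.map-cong f≗g (H n))

outDegree : Word → ℕ
outDegree u = length (rewrites u)

boundaryCount : Word → Digit → ℕ
boundaryCount w d = length (fromMaybe (boundaryRewrite w d))

outDegree-∷ʳ : ∀ w d → outDegree (w ∷ʳ d) ≡ outDegree w + boundaryCount w d
outDegree-∷ʳ w d = begin
  length (rewrites (w ∷ʳ d))
    ≡⟨ cong length (rewrites-∷ʳ w d) ⟩
  length (map (_∷ʳ d) (rewrites w) ++ fromMaybe (boundaryRewrite w d))
    ≡⟨ List.length-++ (map (_∷ʳ d) (rewrites w)) ⟩
  length (map (_∷ʳ d) (rewrites w)) + boundaryCount w d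
    ≡⟨ cong (_+ boundaryCount w d) (List.length-map (_∷ʳ d) (rewrites w)) ⟩
  outDegree w + boundaryCount w d ∎
  where open ≡-Reasoning

outDegree-∷ʳ-≢2 : ∀ w d → d ≢ d2 → outDegree (w ∷ʳ d) ≡ outDegree w
outDegree-∷ʳ-≢2 w d d≢2 = trans (outDegree-∷ʳ w d)
  (trans (cong (λ m → outDegree w + length (fromMaybe m)) (boundaryRewrite-≢2 w d d≢2)) (ℕ.+-identityʳ _))

boundaryCount-∷ʳ : ∀ w e → boundaryCount (w ∷ʳ e) d2 ≡ length (fromMaybe (increment e))
boundaryCount-∷ʳ w e = trans (cong (length ∘ fromMaybe) (boundaryRewrite-∷ʳ w e)) (length-fromMaybe-map (increment e))
  where
  length-fromMaybe-map : ∀ {A B : Set} {f : A → B} (m : Maybe A) →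
                         length (fromMaybe (Maybe.map f m)) ≡ length (fromMaybe m)
  length-fromMaybe-map nothing  = refl
  length-fromMaybe-map (just _) = refl

vertexCount : ℕ → ℕ
vertexCount = sumOverH (λ _ → 1)

arcCount : ℕ → ℕ
arcCount = sumOverH outDegree

-- The number of expansions of n not ending in 2: those admitting a carry when a 2 is appended.
carryCount : ℕ → ℕ
carryCount = sumOverH (λ w → boundaryCount w d2)

vertexCount-odd : ∀ k → vertexCount (2 * k + 1) ≡ vertexCount k
vertexCount-odd = sumOverH-odd (λ _ → 1)

vertexCount-even : ∀ k → vertexCount (2 * k + 2) ≡ vertexCount (suc k) + vertexCount k
vertexCount-even = sumOverH-even (λ _ → 1)

vertexCount-even-≥ˡ : ∀ k → vertexCount (suc k) ≤ vertexCount (2 * k + 2)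
vertexCount-even-≥ˡ k = ℕ.≤-trans (ℕ.m≤m+n (vertexCount (suc k)) (vertexCount k)) (ℕ.≤-reflexive (sym (vertexCount-even k)))

vertexCount-even-≥ʳ : ∀ k → vertexCount k ≤ vertexCount (2 * k + 2)
vertexCount-even-≥ʳ k = ℕ.≤-trans (ℕ.m≤n+m (vertexCount k) (vertexCount (suc k))) (ℕ.≤-reflexive (sym (vertexCount-even k)))

arcCount-odd : ∀ k → arcCount (2 * k + 1) ≡ arcCount k
arcCount-odd k = trans (sumOverH-odd outDegree k) (sumOverH-cong (λ w → outDegree-∷ʳ-≢2 w d1 (λ ())) k)

arcCount-even : ∀ k → arcCount (2 * k + 2) ≡ arcCount (suc k) + (arcCount k + carryCount k)
arcCount-even k = begin
  arcCount (2 * k + 2)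
    ≡⟨ sumOverH-even outDegree k ⟩
  sumOverH (outDegree ∘ (_∷ʳ d0)) (suc k) + sumOverH (outDegree ∘ (_∷ʳ d2)) k
    ≡⟨ cong₂ _+_ (sumOverH-cong (λ w → outDegree-∷ʳ-≢2 w d0 (λ ())) (suc k))
                 (sumOverH-cong (λ w → outDegree-∷ʳ w d2) k) ⟩
  arcCount (suc k) + sumOverH (λ w → outDegree w + boundaryCount w d2) k
    ≡⟨ cong (_+_ (arcCount (suc k))) (sum-map-+ outDegree (λ w → boundaryCount w d2) (H k)) ⟩
  arcCount (suc k) + (arcCount k + carryCount k) ∎
  where open ≡-Reasoning

carryCount-odd : ∀ k → carryCount (2 * k + 1) ≡ vertexCount k
carryCount-odd k = trans (sumOverH-odd _ k) (sumOverH-cong (λ w → boundaryCount-∷ʳ w d1) k)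

carryCount-even : ∀ k → carryCount (2 * k + 2) ≡ vertexCount (suc k)
carryCount-even k = begin
  carryCount (2 * k + 2)
    ≡⟨ sumOverH-even _ k ⟩
  sumOverH (λ w → boundaryCount (w ∷ʳ d0) d2) (suc k) + sumOverH (λ w → boundaryCount (w ∷ʳ d2) d2) k
    ≡⟨ cong₂ _+_ (sumOverH-cong (λ w → boundaryCount-∷ʳ w d0) (suc k))
                 (sumOverH-cong (λ w → boundaryCount-∷ʳ w d2) k) ⟩
  vertexCount (suc k) + sumOverH (λ _ → 0) k
    ≡⟨ cong (_+_ (vertexCount (suc k))) (sum-map-0 (H k)) ⟩
  vertexCount (suc k) + 0
    ≡⟨ ℕ.+-identityʳ _ ⟩
  vertexCount (suc k) ∎
  where open ≡-Reasoning

carryCount-positive : ∀ n → 1 ≤ carryCount n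
carryCount-positive n with b , b∈ , b-binary ← binary-expansion n with _ , eq ← carry-boundary b-binary =
  ℕ.≤-trans (ℕ.≤-reflexive (cong (length ∘ fromMaybe) (sym eq))) (≤-sum-map (λ w → boundaryCount w d2) b∈)

vertexCount≤arcCount+1 : ∀ n → vertexCount n ≤ arcCount n + 1
vertexCount≤arcCount+1 = halving-induction (λ n → vertexCount n ≤ arcCount n + 1) (s≤s z≤n) odd-step even-step
  where
  odd-step : ∀ k → vertexCount k ≤ arcCount k + 1 → vertexCount (2 * k + 1) ≤ arcCount (2 * k + 1) + 1
  odd-step k ih = subst₂ (λ a b → a ≤ b + 1) (sym (vertexCount-odd k)) (sym (arcCount-odd k)) ih
  even-step : ∀ k → vertexCount (suc k) ≤ arcCount (suc k) + 1 → vertexCount k ≤ arcCount k + 1 →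
              vertexCount (2 * k + 2) ≤ arcCount (2 * k + 2) + 1
  even-step k ih₁ ih₀ = begin
    vertexCount (2 * k + 2)                         ≡⟨ vertexCount-even k ⟩
    vertexCount (suc k) + vertexCount k             ≤⟨ ℕ.+-mono-≤ ih₁ ih₀ ⟩
    (arcCount (suc k) + 1) + (arcCount k + 1)       ≡⟨ regroup (arcCount (suc k)) (arcCount k) ⟩
    arcCount (suc k) + (arcCount k + 1) + 1
      ≤⟨ ℕ.+-monoˡ-≤ 1 (ℕ.+-monoʳ-≤ (arcCount (suc k)) (ℕ.+-monoʳ-≤ (arcCount k) (carryCount-positive k))) ⟩
    arcCount (suc k) + (arcCount k + carryCount k) + 1 ≡⟨ cong (_+ 1) (arcCount-even k) ⟨
    arcCount (2 * k + 2) + 1                        ∎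
    where
    open ℕ.≤-Reasoning
    regroup : ∀ a b → (a + 1) + (b + 1) ≡ a + (b + 1) + 1
    regroup = solve-∀

excess : ℕ → ℕ
excess n = arcCount n + 1 ∸ vertexCount n

arcCount+1≡vertexCount+excess : ∀ n → arcCount n + 1 ≡ vertexCount n + excess n
arcCount+1≡vertexCount+excess n = sym (ℕ.m+[n∸m]≡n (vertexCount≤arcCount+1 n))

excess-unique : ∀ n d → arcCount n + 1 ≡ vertexCount n + d → excess n ≡ d
excess-unique n d eq = trans (cong (_∸ vertexCount n) eq) (ℕ.m+n∸m≡n (vertexCount n) d)

excess-odd : ∀ k → excess (2 * k + 1) ≡ excess k
excess-odd k = cong₂ (λ a b → a + 1 ∸ b) (arcCount-odd k) (vertexCount-odd k)

excess-even : ∀ k → excess (2 * k + 2) ≡ excess (suc k) + excess k + (carryCount k ∸ 1)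
excess-even k = excess-unique (2 * k + 2) (excess (suc k) + excess k + (carryCount k ∸ 1)) (begin
  arcCount (2 * k + 2) + 1
    ≡⟨ cong (_+ 1) (arcCount-even k) ⟩
  arcCount (suc k) + (arcCount k + carryCount k) + 1
    ≡⟨ cong (λ c → arcCount (suc k) + (arcCount k + c) + 1) (ℕ.m+[n∸m]≡n (carryCount-positive k)) ⟨
  arcCount (suc k) + (arcCount k + suc (carryCount k ∸ 1)) + 1
    ≡⟨ regroup (arcCount (suc k)) (arcCount k) (carryCount k ∸ 1) ⟩
  (arcCount (suc k) + 1) + (arcCount k + 1) + (carryCount k ∸ 1)
    ≡⟨ cong₂ (λ x y → x + y + (carryCount k ∸ 1))
             (arcCount+1≡vertexCount+excess (suc k)) (arcCount+1≡vertexCount+excess k) ⟩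
  (vertexCount (suc k) + excess (suc k)) + (vertexCount k + excess k) + (carryCount k ∸ 1)
    ≡⟨ interchange (vertexCount (suc k)) (excess (suc k)) (vertexCount k) (excess k) (carryCount k ∸ 1) ⟩
  (vertexCount (suc k) + vertexCount k) + (excess (suc k) + excess k + (carryCount k ∸ 1))
    ≡⟨ cong (_+ (excess (suc k) + excess k + (carryCount k ∸ 1))) (vertexCount-even k) ⟨
  vertexCount (2 * k + 2) + (excess (suc k) + excess k + (carryCount k ∸ 1)) ∎)
  where
  open ≡-Reasoning
  regroup : ∀ a b c → a + (b + suc c) + 1 ≡ (a + 1) + (b + 1) + c
  regroup = solve-∀
  interchange : ∀ n₁ d₁ n₀ d₀ c → (n₁ + d₁) + (n₀ + d₀) + c ≡ (n₁ + n₀) + (d₁ + d₀ + c)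
  interchange = solve-∀

T-any-==⇔∈ : ∀ {w : Word} {ws} → T (any (_== w) ws) ⇔ w ∈ ws
T-any-==⇔∈ {w} {ws} =
  mk⇔ (Any.map (sym ∘ toWitness) ∘ any⁻ (_== w) ws) (any⁺ (_== w) ∘ Any.map (fromWitness ∘ sym))

out-neighbours↭rewrites : ∀ n {u} → u ∈ H n → boolFilter (isArcForm u) (H n) ↭ rewrites u
out-neighbours↭rewrites n {u} u∈ = unique-↭ (boolFilter-unique (isArcForm u) (H-unique n)) (rewrites-unique u) to from
  where
  to : ∀ {w} → w ∈ boolFilter (isArcForm u) (H n) → w ∈ rewrites u
  to w∈ = Equivalence.to T-any-==⇔∈ (proj₂ (∈-boolFilter⁻ (isArcForm u) {H n} w∈))
  from : ∀ {w} → w ∈ rewrites u → w ∈ boolFilter (isArcForm u) (H n)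
  from w∈ = ∈-boolFilter⁺ (isArcForm u) (∈-rewrites-H n u∈ w∈) (Equivalence.from T-any-==⇔∈ w∈)

length-arcs : ∀ n → length (arcs n) ≡ arcCount n
length-arcs n = trans (length-boolFilter-pairs (λ p → isArcForm (proj₁ p) (proj₂ p)) (H n) (H n))
  (cong sum (List.map-cong-local (All.tabulate λ u∈ → ↭.↭-length (out-neighbours↭rewrites n u∈))))

Arc : Word → Word → Set
Arc u w = w ∈ rewrites u

Adjacent : ℕ → Word → Word → Set
Adjacent n u w = T (adj n u w)

adjacent⁺ : ∀ n {u w} → u ∈ H n → w ∈ H n → Arc u w ⊎ Arc w u → Adjacent n u w
adjacent⁺ n u∈ w∈ arc = Equivalence.from T-∧
  ( Equivalence.from T-∧ (Equivalence.from T-any-==⇔∈ u∈ , Equivalence.from T-any-==⇔∈ w∈)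
  , Equivalence.from T-∨ (Sum.map (Equivalence.from T-any-==⇔∈) (Equivalence.from T-any-==⇔∈) arc))

adjacent⁻ : ∀ n {u w} → Adjacent n u w → u ∈ H n × w ∈ H n × (Arc u w ⊎ Arc w u)
adjacent⁻ n a with members , arc ← Equivalence.to T-∧ a with u∈ , w∈ ← Equivalence.to T-∧ members =
  Equivalence.to T-any-==⇔∈ u∈ , Equivalence.to T-any-==⇔∈ w∈ ,
  Sum.map (Equivalence.to T-any-==⇔∈) (Equivalence.to T-any-==⇔∈) (Equivalence.to T-∨ arc)

adjacent-sym : ∀ n {u w} → Adjacent n u w → Adjacent n w u
adjacent-sym n a with u∈ , w∈ , arc ← adjacent⁻ n a = adjacent⁺ n w∈ u∈ (Sum.swap arc)

adjacent-∷ʳ : ∀ n m d → (∀ {z} → z ∈ H n → (z ∷ʳ d) ∈ H m) →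
              ∀ {u w} → Adjacent n u w → Adjacent m (u ∷ʳ d) (w ∷ʳ d)
adjacent-∷ʳ n m d lift {u} {w} a with u∈ , w∈ , arc ← adjacent⁻ n a =
  adjacent⁺ m (lift u∈) (lift w∈) (Sum.map (∈-rewrites-∷ʳ u d) (∈-rewrites-∷ʳ w d) arc)

infixl 5 _▷_
data Walk (n : ℕ) (u : Word) : ℕ → Word → Set where
  []  : Walk n u 0 u
  _▷_ : ∀ {ℓ z w} → Walk n u ℓ z → Adjacent n z w → Walk n u (suc ℓ) w

module _ {n : ℕ} where

  infixr 5 _◁_
  _◁_ : ∀ {u z w ℓ} → Adjacent n u z → Walk n z ℓ w → Walk n u (suc ℓ) w
  a ◁ []      = [] ▷ a
  a ◁ (p ▷ b) = (a ◁ p) ▷ b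

  _++ʷ_ : ∀ {u z w i j} → Walk n u i z → Walk n z j w → Walk n u (j + i) w
  p ++ʷ []      = p
  p ++ʷ (q ▷ a) = (p ++ʷ q) ▷ a

  reverse : ∀ {u w ℓ} → Walk n u ℓ w → Walk n w ℓ u
  reverse []      = []
  reverse (p ▷ a) = adjacent-sym n a ◁ reverse p

  walk⇒conn : ∀ {u w ℓ} → Walk n u ℓ w → T (conn n ℓ u w)
  walk⇒conn []      = fromWitness refl
  walk⇒conn (p ▷ a) = Equivalence.from T-∨ (inj₂ (any⁺ _
    (Any.map (λ { refl → Equivalence.from T-∧ (walk⇒conn p , a) }) (proj₁ (adjacent⁻ n a)))))

  conn-mono : ∀ {u w ℓ m} → ℓ ≤ m → T (conn n ℓ u w) → T (conn n m u w)
  conn-mono ℓ≤m = go (ℕ.≤⇒≤‴ ℓ≤m)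
    where
    go : ∀ {u w ℓ m} → ℓ ≤‴ m → T (conn n ℓ u w) → T (conn n m u w)
    go (≤‴-reflexive refl) c = c
    go (≤‴-step ℓ<m)       c = go ℓ<m (Equivalence.from T-∨ (inj₁ c))

walk-∷ʳ : ∀ n m d → (∀ {z} → z ∈ H n → (z ∷ʳ d) ∈ H m) →
          ∀ {u w ℓ} → Walk n u ℓ w → Walk m (u ∷ʳ d) ℓ (w ∷ʳ d)
walk-∷ʳ n m d lift []      = []
walk-∷ʳ n m d lift (p ▷ a) = walk-∷ʳ n m d lift p ▷ adjacent-∷ʳ n m d lift a

ShortWalk : ℕ → Word → Word → Set
ShortWalk n u w = ∃ λ ℓ → ℓ < vertexCount n × Walk n u ℓ w

Connected : ℕ → Set
Connected n = ∀ {u w} → u ∈ H n → w ∈ H n → ShortWalk n u w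

-- The binary expansion b of k does not end in 2, so b2 has a carry arc b2 → z0; it joins the two
-- halves of H(2k+2).
crossing-walk : ∀ k → Connected (suc k) → Connected k → ∀ {i j} → i ∈ H (suc k) → j ∈ H k →
                ShortWalk (2 * k + 2) (i ∷ʳ d0) (j ∷ʳ d2)
crossing-walk k ih₁ ih₀ i∈ j∈
  with b , b∈ , b-binary ← binary-expansion k
  with z , carry ← carry-boundary b-binary =
  let b2∈ = ∈-H-even₂⁺ k b∈
      z0∈ = ∈-rewrites-H (2 * k + 2) b2∈ (∈-boundaryRewrite b d2 carry)
      carry-edge = adjacent⁺ (2 * k + 2) z0∈ b2∈ (inj₂ (∈-boundaryRewrite b d2 carry))
      ℓ₁ , ℓ₁< , p₁ = ih₁ i∈ (∈-H-even₀⁻ k z0∈)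
      ℓ₀ , ℓ₀< , p₀ = ih₀ b∈ j∈
  in ℓ₀ + suc ℓ₁
   , (begin
       suc ℓ₀ + suc ℓ₁                     ≤⟨ ℕ.+-mono-≤ ℓ₀< ℓ₁< ⟩
       vertexCount k + vertexCount (suc k) ≡⟨ ℕ.+-comm (vertexCount k) _ ⟩
       vertexCount (suc k) + vertexCount k ≡⟨ vertexCount-even k ⟨
       vertexCount (2 * k + 2)             ∎)
   , (walk-∷ʳ (suc k) (2 * k + 2) d0 (∈-H-even₀⁺ k) p₁ ▷ carry-edge)
     ++ʷ walk-∷ʳ k (2 * k + 2) d2 (∈-H-even₂⁺ k) p₀
  where open ℕ.≤-Reasoning

walk-even₀ : ∀ k → Connected (suc k) → ∀ {i j} → i ∈ H (suc k) → j ∈ H (suc k) →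
             ShortWalk (2 * k + 2) (i ∷ʳ d0) (j ∷ʳ d0)
walk-even₀ k ih i∈ j∈ with ℓ , ℓ< , p ← ih i∈ j∈ =
  ℓ , ℕ.<-≤-trans ℓ< (vertexCount-even-≥ˡ k) ,
  walk-∷ʳ (suc k) (2 * k + 2) d0 (∈-H-even₀⁺ k) p

walk-even₂ : ∀ k → Connected k → ∀ {i j} → i ∈ H k → j ∈ H k →
             ShortWalk (2 * k + 2) (i ∷ʳ d2) (j ∷ʳ d2)
walk-even₂ k ih i∈ j∈ with ℓ , ℓ< , p ← ih i∈ j∈ =
  ℓ , ℕ.<-≤-trans ℓ< (vertexCount-even-≥ʳ k) ,
  walk-∷ʳ k (2 * k + 2) d2 (∈-H-even₂⁺ k) p

connected-0 : Connected 0
connected-0 (here refl) (here refl) = 0 , s≤s z≤n , []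

connected-odd : ∀ k → Connected k → Connected (2 * k + 1)
connected-odd k ih u∈ w∈ with i , i∈ , refl ← ∈-H-odd⁻ k u∈ | j , j∈ , refl ← ∈-H-odd⁻ k w∈
                         with ℓ , ℓ< , p ← ih i∈ j∈ =
  ℓ , subst (ℓ <_) (sym (vertexCount-odd k)) ℓ< , walk-∷ʳ k (2 * k + 1) d1 (∈-H-odd⁺ k) p

connected-even : ∀ k → Connected (suc k) → Connected k → Connected (2 * k + 2)
connected-even k ih₁ ih₀ u∈ w∈ = join (∈-H-even⁻ k u∈) (∈-H-even⁻ k w∈)
  where
  join : ∀ {u w} → EvenSplit k u → EvenSplit k w → ShortWalk (2 * k + 2) u w
  join (inj₁ (i , i∈ , refl)) (inj₁ (j , j∈ , refl)) = walk-even₀ k ih₁ i∈ j∈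
  join (inj₂ (i , i∈ , refl)) (inj₂ (j , j∈ , refl)) = walk-even₂ k ih₀ i∈ j∈
  join (inj₁ (i , i∈ , refl)) (inj₂ (j , j∈ , refl)) = crossing-walk k ih₁ ih₀ i∈ j∈
  join (inj₂ (i , i∈ , refl)) (inj₁ (j , j∈ , refl)) =
    Product.map₂ (Product.map₂ reverse) (crossing-walk k ih₁ ih₀ j∈ i∈)

connected : ∀ n → Connected n
connected = halving-induction Connected connected-0 connected-odd connected-even

length-H : ∀ n → length (H n) ≡ vertexCount n
length-H n = sym (sum-map-1 (H n))

conn-complete : ∀ n {u w} → u ∈ H n → w ∈ H n → T (conn n (length (H n)) u w)
conn-complete n u∈ w∈ =
  let ℓ , ℓ< , p = connected n u∈ w∈
  in conn-mono (ℕ.≤-trans (ℕ.<⇒≤ ℓ<) (ℕ.≤-reflexive (sym (length-H n)))) (walk⇒conn p)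

-- As for `rewrites` above, `go` names the where-bound helper of `countComponents`.
mutual
  go : ℕ → List Word → List Word → ℕ
  go = _

  private
    go-solution : ∀ n → countComponents n ≡ countComponents n
    go-solution n with H n
    ... | []     = refl
    ... | u ∷ us with [ u ]
    ...   | seen = refl {x = suc (go n seen us)}

go-connected : ∀ n {h seen} us → h ∈ seen → (∀ {u} → u ∈ us → T (conn n (length (H n)) h u)) →
               go n seen us ≡ 0
go-connected n []       h∈ h-conn = refl
go-connected n {h} {seen} (u ∷ us) h∈ h-conn
  with any (λ z → conn n (length (H n)) z u) seen
     | any⁺ (λ z → conn n (length (H n)) z u) (Any.map (λ { refl → h-conn (here refl) }) h∈)
... | true | _ = go-connected n us (there h∈) (h-conn ∘ there)

countComponents≡1 : ∀ n → countComponents n ≡ 1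
countComponents≡1 n = go-from (H n) refl
  where
  go-from : ∀ vs → H n ≡ vs → go n [] vs ≡ 1
  go-from []       eq with b , b∈ , _ ← binary-expansion n with () ← subst (_ ∈_) eq b∈
  go-from (h ∷ us) eq = cong suc (go-connected n us (here refl)
    (λ u∈ → conn-complete n (subst (h ∈_) (sym eq) (here refl)) (subst (_ ∈_) (sym eq) (there u∈))))

v≡excess : ∀ n → v n ≡ + excess n
v≡excess n = begin
  (+ length (arcs n) -ℤ + length (H n)) +ℤ + countComponents n
    ≡⟨ cong₂ (λ a c → (+ a -ℤ + length (H n)) +ℤ + c) (length-arcs n) (countComponents≡1 n) ⟩
  (+ arcCount n -ℤ + length (H n)) +ℤ + 1
    ≡⟨ cong (λ m → (+ arcCount n -ℤ + m) +ℤ + 1) (length-H n) ⟩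
  (+ arcCount n -ℤ + vertexCount n) +ℤ + 1
    ≡⟨ move-1 (+ arcCount n) (+ vertexCount n) ⟩
  + (arcCount n + 1) -ℤ + vertexCount n
    ≡⟨ cong (λ m → + m -ℤ + vertexCount n) (arcCount+1≡vertexCount+excess n) ⟩
  + (vertexCount n + excess n) -ℤ + vertexCount n
    ≡⟨ cancel (vertexCount n) (excess n) ⟩
  + excess n ∎
  where
  open ≡-Reasoning
  move-1 : ∀ a b → (a -ℤ b) +ℤ + 1 ≡ (a +ℤ + 1) -ℤ b
  move-1 = ℤ-Solver.solve-∀
  cancel : ∀ a d → + (a + d) -ℤ + a ≡ + d
  cancel a d = trans (cong (_-ℤ + a) (ℤ.pos-+ a d)) (cancel′ (+ a) (+ d))
    where
    cancel′ : ∀ a d → (a +ℤ d) -ℤ a ≡ d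
    cancel′ = ℤ-Solver.solve-∀

⊓-idemˡ : ∀ K a → K ⊓ (K ⊓ a) ≡ K ⊓ a
⊓-idemˡ K a = trans (sym (ℕ.⊓-assoc K K a)) (cong (_⊓ a) (ℕ.⊓-idem K))

⊓-+ˡ : ∀ K a b → K ⊓ (a + b) ≡ K ⊓ (K ⊓ a + b)
⊓-+ˡ zero    a       b = refl
⊓-+ˡ (suc K) zero    b = refl
⊓-+ˡ (suc K) (suc a) b = cong suc (⊓-+ˡ K a b)

⊓-+-cong : ∀ K {a a′ b b′} → K ⊓ a ≡ K ⊓ a′ → K ⊓ b ≡ K ⊓ b′ → K ⊓ (a + b) ≡ K ⊓ (a′ + b′)
⊓-+-cong K {a} {a′} {b} {b′} eqa eqb = begin
  K ⊓ (a + b)         ≡⟨ ⊓-+ˡ K a b ⟩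
  K ⊓ (K ⊓ a + b)     ≡⟨ cong (λ x → K ⊓ (x + b)) eqa ⟩
  K ⊓ (K ⊓ a′ + b)    ≡⟨ cong (K ⊓_) (ℕ.+-comm (K ⊓ a′) b) ⟩
  K ⊓ (b + K ⊓ a′)    ≡⟨ ⊓-+ˡ K b _ ⟩
  K ⊓ (K ⊓ b + K ⊓ a′) ≡⟨ cong (λ x → K ⊓ (x + K ⊓ a′)) eqb ⟩
  K ⊓ (K ⊓ b′ + K ⊓ a′) ≡⟨ ⊓-+ˡ K b′ _ ⟨
  K ⊓ (b′ + K ⊓ a′)   ≡⟨ cong (K ⊓_) (ℕ.+-comm b′ (K ⊓ a′)) ⟩
  K ⊓ (K ⊓ a′ + b′)   ≡⟨ ⊓-+ˡ K a′ b′ ⟨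
  K ⊓ (a′ + b′)       ∎
  where open ≡-Reasoning

⊓-+ : ∀ K a b → K ⊓ (a + b) ≡ K ⊓ (K ⊓ a + K ⊓ b)
⊓-+ K a b = ⊓-+-cong K (sym (⊓-idemˡ K a)) (sym (⊓-idemˡ K b))

⊓-∸1 : ∀ K c → K ⊓ (c ∸ 1) ≡ K ⊓ (suc K ⊓ c ∸ 1)
⊓-∸1 K zero    = refl
⊓-∸1 K (suc c) = sym (⊓-idemˡ K c)

⊓-double : ∀ K x → K ⊓ (2 * x) ≡ K ⊓ (2 * (K ⊓ x))
⊓-double K x = ⊓-+-cong K x≈ (⊓-+-cong K x≈ refl)
  where
  x≈ : K ⊓ x ≡ K ⊓ (K ⊓ x)
  x≈ = sym (⊓-idemˡ K x)

⊓≡⇔ : ∀ {K m} x → m < K → K ⊓ x ≡ m ⇔ x ≡ m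
⊓≡⇔ {K} {m} x m<K = mk⇔ to λ { refl → ℕ.m≥n⇒m⊓n≡n (ℕ.<⇒≤ m<K) }
  where
  to : K ⊓ x ≡ m → x ≡ m
  to eq with ℕ.⊓-sel K x
  ... | inj₁ K⊓x≡K = ⊥-elim (ℕ.<⇒≢ m<K (trans (sym eq) K⊓x≡K))
  ... | inj₂ K⊓x≡x = trans (sym K⊓x≡x) eq

Profile : Set
Profile = ℕ × ℕ × ℕ

-- excess saturated at 3 still tells whether it is 2; carryCount is saturated at 4 so that
-- carryCount ∸ 1 is known up to 3, and vertexCount at 4 because carryCount takes its values.
profile : ℕ → Profile
profile m = 3 ⊓ excess m , 4 ⊓ vertexCount m , 4 ⊓ carryCount m

oddProfile : Profile → Profile
oddProfile (e , n , _) = e , n , n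

evenProfile : Profile → Profile → Profile
evenProfile (e₀ , n₀ , c₀) (e₁ , n₁ , _) = 3 ⊓ (e₁ + e₀ + (c₀ ∸ 1)) , 4 ⊓ (n₁ + n₀) , n₁

profile-odd : ∀ k → profile (2 * k + 1) ≡ oddProfile (profile k)
profile-odd k = cong₂ _,_ (cong (3 ⊓_) (excess-odd k))
                  (cong₂ _,_ (cong (4 ⊓_) (vertexCount-odd k)) (cong (4 ⊓_) (carryCount-odd k)))

profile-even : ∀ k → profile (2 * k + 2) ≡ evenProfile (profile k) (profile (suc k))
profile-even k = cong₂ _,_
  (trans (cong (3 ⊓_) (excess-even k))
         (⊓-+-cong 3 (⊓-+ 3 (excess (suc k)) (excess k)) (⊓-∸1 3 (carryCount k))))
  (cong₂ _,_ (trans (cong (4 ⊓_) (vertexCount-even k)) (⊓-+ 4 (vertexCount (suc k)) (vertexCount k)))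
             (cong (4 ⊓_) (carryCount-even k)))

State : Set
State = ℕ × Profile × Profile

-- state k is attached to m = k + 1: the even number 2m saturated at 32 (which still tells 18, 22, 24
-- and 28 apart), and the profiles of m - 1 and m.
state : ℕ → State
state k = 32 ⊓ (2 * k + 2) , profile k , profile (suc k)

next₀ : State → State
next₀ (M , p , q) = 32 ⊓ (2 * M) , oddProfile p , evenProfile p q

next₁ : State → State
next₁ (M , p , q) = 32 ⊓ (2 * M + 2) , evenProfile p q , oddProfile q

state-odd : ∀ k → state (2 * k + 1) ≡ next₀ (state k)
state-odd k = cong₂ _,_
  (trans (cong (32 ⊓_) (4k+4 k)) (⊓-double 32 (2 * k + 2)))
  (cong₂ _,_ (profile-odd k) (trans (cong profile (+1+1 k)) (profile-even k)))
  where
  4k+4 : ∀ k → 2 * (2 * k + 1) + 2 ≡ 2 * (2 * k + 2)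
  4k+4 = solve-∀
  +1+1 : ∀ k → suc (2 * k + 1) ≡ 2 * k + 2
  +1+1 = solve-∀

state-even : ∀ k → state (2 * k + 2) ≡ next₁ (state k)
state-even k = cong₂ _,_
  (⊓-+-cong 32 (⊓-double 32 (2 * k + 2)) refl)
  (cong₂ _,_ (profile-even k) (trans (cong profile (+2+1 k)) (profile-odd (suc k))))
  where
  +2+1 : ∀ k → suc (2 * k + 2) ≡ 2 * suc k + 1
  +2+1 = solve-∀

_≟ˢ_ : DecidableEquality State
_≟ˢ_ = Product.≡-dec ℕ._≟_ (Product.≡-dec profile-≟ profile-≟)
  where
  profile-≟ : DecidableEquality Profile
  profile-≟ = Product.≡-dec ℕ._≟_ (Product.≡-dec ℕ._≟_ ℕ._≟_)

successors : State → List State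
successors s = next₀ s ∷ next₁ s ∷ []

explore : ℕ → List State → List State
explore zero       S = S
explore (suc fuel) S = explore fuel (deduplicate _≟ˢ_ (S ++ concatMap successors S))

-- Seven rounds suffice to reach a closed set, as reachable-closed certifies.
reachable : List State
reachable = explore 7 [ state 0 ]

reachable-closed : All (λ s → All (_∈ reachable) (successors s)) reachable
reachable-closed = from-yes (all? (λ s → all? (λ t → _∈?_ _≟ˢ_ t reachable) (successors s)) reachable)

Target : ℕ → Set
Target n = n ≡ 18 ⊎ n ≡ 22 ⊎ n ≡ 24 ⊎ n ≡ 28

target? : ∀ n → Dec (Target n)
target? n = n ℕ.≟ 18 ⊎-dec n ℕ.≟ 22 ⊎-dec n ℕ.≟ 24 ⊎-dec n ℕ.≟ 28

Target-⊓32 : ∀ n → Target (32 ⊓ n) ⇔ Target n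
Target-⊓32 n = mk⇔ to from
  where
  to : Target (32 ⊓ n) → Target n
  to t with ℕ.⊓-sel 32 n
  ... | inj₁ eq = ⊥-elim (¬Target-32 (subst Target eq t))
    where
    ¬Target-32 : Target 32 → ⊥
    ¬Target-32 (inj₁ ())
    ¬Target-32 (inj₂ (inj₁ ()))
    ¬Target-32 (inj₂ (inj₂ (inj₁ ())))
    ¬Target-32 (inj₂ (inj₂ (inj₂ ())))
  ... | inj₂ eq = subst Target eq t
  from : Target n → Target (32 ⊓ n)
  from (inj₁ refl)                = inj₁ refl
  from (inj₂ (inj₁ refl))         = inj₂ (inj₁ refl)
  from (inj₂ (inj₂ (inj₁ refl)))  = inj₂ (inj₂ (inj₁ refl))
  from (inj₂ (inj₂ (inj₂ refl)))  = inj₂ (inj₂ (inj₂ refl))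

Correct : State → Set
Correct (M , p , q) = (proj₁ (evenProfile p q) ≡ 2 → Target M) × (Target M → proj₁ (evenProfile p q) ≡ 2)

reachable-correct : All Correct reachable
reachable-correct = from-yes (all? correct? reachable)
  where
  correct? : ∀ s → Dec (Correct s)
  correct? (M , p , q) =
    (proj₁ (evenProfile p q) ℕ.≟ 2 →-dec target? M) ×-dec (target? M →-dec proj₁ (evenProfile p q) ℕ.≟ 2)

state-reachable : ∀ k → state k ∈ reachable
state-reachable = halving-induction (λ k → state k ∈ reachable) (here refl)
  (λ k ih → subst (_∈ reachable) (sym (state-odd k)) (All.head (All.lookup reachable-closed ih)))
  (λ k _ ih → subst (_∈ reachable) (sym (state-even k)) (All.head (All.tail (All.lookup reachable-closed ih))))

excess-even≡2⇔Target : ∀ k → excess (2 * k + 2) ≡ 2 ⇔ Target (2 * k + 2)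
excess-even≡2⇔Target k = mk⇔ to from
  where
  n = 2 * k + 2
  correct : Correct (state k)
  correct = All.lookup reachable-correct (state-reachable k)
  e≡ : 3 ⊓ excess n ≡ proj₁ (evenProfile (profile k) (profile (suc k)))
  e≡ = cong proj₁ (profile-even k)
  saturate : 3 ⊓ excess n ≡ 2 ⇔ excess n ≡ 2
  saturate = ⊓≡⇔ (excess n) ℕ.≤-refl
  to : excess n ≡ 2 → Target n
  to e = Equivalence.to (Target-⊓32 n) (proj₁ correct (trans (sym e≡) (Equivalence.from saturate e)))
  from : Target n → excess n ≡ 2
  from t = Equivalence.to saturate (trans e≡ (proj₂ correct (Equivalence.from (Target-⊓32 n) t)))

v-even≡2⇔Target : ∀ k → v (2 * k + 2) ≡ + 2 ⇔ Target (2 * k + 2)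
v-even≡2⇔Target k = mk⇔ (to ∘ ℤ.+-injective ∘ trans (sym (v≡excess (2 * k + 2))))
                        (trans (v≡excess (2 * k + 2)) ∘ cong +_ ∘ from)
  where open Equivalence (excess-even≡2⇔Target k)

Target⇒even : ∀ {n} → Target n → ∃ λ k → n ≡ 2 * k + 2
Target⇒even (inj₁ refl)               = 8 , refl
Target⇒even (inj₂ (inj₁ refl))        = 10 , refl
Target⇒even (inj₂ (inj₂ (inj₁ refl))) = 11 , refl
Target⇒even (inj₂ (inj₂ (inj₂ refl))) = 13 , refl

mainTheorem2 : (n : ℕ) →
    ((2 ∣ n) × (v n ≡ + 2)) ⇔ (n ≡ 18 ⊎ n ≡ 22 ⊎ n ≡ 24 ⊎ n ≡ 28)
mainTheorem2 n = mk⇔ to from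
  where
  2[1+k]≡2k+2 : ∀ k → suc k * 2 ≡ 2 * k + 2
  2[1+k]≡2k+2 = solve-∀
  to : (2 ∣ n) × (v n ≡ + 2) → Target n
  to (divides zero    refl , v≡2) with () ← ℤ.+-injective (trans (sym (v≡excess 0)) v≡2)
  to (divides (suc k) refl , v≡2) = subst Target (sym (2[1+k]≡2k+2 k))
    (Equivalence.to (v-even≡2⇔Target k) (subst (λ m → v m ≡ + 2) (2[1+k]≡2k+2 k) v≡2))
  from : Target n → (2 ∣ n) × (v n ≡ + 2)
  from t with k , refl ← Target⇒even t =
    divides (suc k) (sym (2[1+k]≡2k+2 k)) , Equivalence.from (v-even≡2⇔Target k) t
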